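{- Let $\mathcal{X}$ be a connected $n$-premaniplex with base flag $x_0$, $N=\mathrm{Stab}_{\mathcal{C}^n}(x_0)$, and let $(\mathcal{Y},\eta)$ be an $(n,m)$-voltage operator that preserves connectivity, with base flag $y_0$ of $\mathcal{Y}$, $L=\mathrm{Stab}_{\mathcal{C}^m}(y_0)$, $\zeta:L\to\mathcal{C}^n$, $\zeta(\omega)=\eta(P_\omega(y_0))$, and for $\upsilon\in\mathcal{C}^m$ let $\mathcal{Z}_\upsilon=\mathcal{C}^n/\zeta(L\cap L^\upsilon)$. If for every $\upsilon\in\mathcal{C}^m\setminus L$ the premaniplex $\mathcal{X}$ does not cover $\mathcal{Z}_\upsilon$, then every automorphism of $\mathcal{X}\rtimes_\eta\mathcal{Y}$ is induced by an automorphism of $\mathcal{X}$.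
   Context: A graph may have multiple edges and semi-edges. An $n$-premaniplex is such a graph with edges coloured by $\{0,\dots,n-1\}$ so that every vertex (flag) is the starting point of exactly one dart of each colour, and whenever $|i-j|\ge2$ every alternating path of length 4 with colours $i,j$ is closed; $x^i$ is the end of the $i$-dart at $x$. $\mathcal{C}^n=\langle r_0,\dots,r_{n-1}\mid r_i^2=1,\ (r_ir_j)^2=1\ (|i-j|\ge2)\rangle$ acts on the left on flags by $r_ix=x^i$; $\mathrm{Stab}$ denotes stabilisers, and $H^\upsilon=\upsilon^{ -1}H\upsilon$. Homomorphisms of premaniplexes preserve all $i$-adjacencies; $\mathcal{X}$ covers $\mathcal{Z}$ if there is a surjective homomorphism $\mathcal{X}\to\mathcal{Z}$; automorphisms are bijective self-homomorphisms acting on the right. For $K\le\mathcal{C}^n$ the coset premaniplex $\mathcal{C}^n/K$ has flags the left cosets $\omega K$ with $i$-adjacency $\omega K\mapsto r_i\omega K$. For a flag $y$ of an $m$-premaniplex $\mathcal{Y}$ and $\omega\in\mathcal{C}^m$, $P_\omega(y)$ is the homotopy class of paths from $y$ whose successive colours $i_1,\dots,i_k$ satisfy $r_{i_k}\cdots r_{i_1}=\omega$ (homotopic iff same start and same element of $\mathcal{C}^m$); they end at $\omega y$; these form the fundamental groupoid $\Pi(\mathcal{Y})$. A voltage assignment $\eta:\Pi(\mathcal{Y})\to\mathcal{C}^n$ satisfies $\eta(W_1W_2)=\eta(W_2)\eta(W_1)$; $(\mathcal{Y},\eta)$ is an $(n,m)$-voltage operator; $\zeta$ is then a group homomorphism.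 $\mathcal{X}\rtimes_\eta\mathcal{Y}$ is the $m$-premaniplex with flags $\mathcal{X}\times\mathcal{Y}$ and $(x,y)^i=(\eta(P_{r_i}(y))x,y^i)$. The operator preserves connectivity if $\mathcal{X}'\rtimes_\eta\mathcal{Y}$ is connected for every connected $n$-premaniplex $\mathcal{X}'$. An automorphism of $\mathcal{X}\rtimes_\eta\mathcal{Y}$ is induced by $\sigma\in\mathrm{Aut}(\mathcal{X})$ if it equals $(x,y)\mapsto(x\sigma,y)$. Standing assumption: $\mathcal{Y}$ has a spanning tree all of whose darts have trivial voltage. -}

module Defs where

open import Data.Nat using (ℕ; zero; suc; _≤_; _<_; ∣_-_∣)
open import Data.Fin using (Fin; toℕ)
open import Data.List using (List; []; _∷_; _++_; reverse)
open import Data.Product using (Σ; _×_; _,_; ∃; ∃-syntax)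
open import Relation.Binary.PropositionalEquality using (_≡_; _≢_)
open import Function.Bundles using (_↔_; Inverse)

-- The group C^n, presented by words in the generators r_0 … r_{n-1}.
-- A word  i₁ ∷ i₂ ∷ … ∷ i_k ∷ []  denotes the product r_{i₁} r_{i₂} ⋯ r_{i_k};
-- the product of group elements is concatenation of words.

Word : ℕ → Set
Word n = List (Fin n)

Far : {n : ℕ} → Fin n → Fin n → Set
Far i j = 2 ≤ ∣ toℕ i - toℕ j ∣

infix 4 _≈_
data _≈_ {n : ℕ} : Word n → Word n → Set where
  ≈-refl  : ∀ {u} → u ≈ u
  ≈-sym   : ∀ {u v} → u ≈ v → v ≈ u
  ≈-trans : ∀ {u v w} → u ≈ v → v ≈ w → u ≈ w
  ≈-cong  : ∀ {u u' v v'} → u ≈ u' → v ≈ v' → u ++ v ≈ u' ++ v'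
  ≈-inv   : ∀ i → (i ∷ i ∷ []) ≈ []
  ≈-comm  : ∀ i j → Far i j → (i ∷ j ∷ i ∷ j ∷ []) ≈ []

-- inverse of a word (all generators are involutions)
inv : {n : ℕ} → Word n → Word n
inv = reverse

-- n-edge-coloured graphs in which every vertex has exactly one dart of
-- each colour: given by the "i-adjacent flag" functions x ↦ x^i.

record Coloured (n : ℕ) : Set₁ where
  field
    Flag : Set
    adj  : Fin n → Flag → Flag

open Coloured public

act : {n : ℕ} (G : Coloured n) → Word n → Flag G → Flag G
act G []      x = x
act G (i ∷ w) x = adj G i (act G w x)

Connected : {n : ℕ} → Coloured n → Set
Connected G = ∀ x x' → Σ (Word _) λ w → act G w x ≡ x'

record Automorphism {n : ℕ} (G : Coloured n) : Set where
  field
    bij      : Flag G ↔ Flag G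
    preserve : ∀ i x → Inverse.to bij (adj G i x) ≡ adj G i (Inverse.to bij x)

record Premaniplex (n : ℕ) : Set₁ where
  field
    graph : Coloured n
    involution  : ∀ i x → adj graph i (adj graph i x) ≡ x
    alternating : ∀ i j → Far i j → ∀ x →
                  adj graph i (adj graph j (adj graph i (adj graph j x))) ≡ x

open Premaniplex public using (graph)

-- Voltage assignments on the fundamental groupoid Π(Y).
-- The homotopy class P_ω(y) is determined by (y, ω); so η is a function
-- of a start flag y and an element ω of C^m (a word up to ≈).
-- Concatenating P_ω(y) and then P_ω'(ωy) gives P_{ω'ω}(y), and
-- η(W₁W₂) = η(W₂)η(W₁).

record VoltageOperator (n m : ℕ) : Set₁ where
  field
    Y       : Premaniplex m
    η       : Flag (graph Y) → Word m → Word n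
    η-resp  : ∀ y {ω ω'} → ω ≈ ω' → η y ω ≈ η y ω'
    η-comp  : ∀ y ω ω' → η y (ω' ++ ω) ≈ (η (act (graph Y) ω y) ω' ++ η y ω)

open VoltageOperator public

-- A spanning tree of Y, presented as a rooted tree: each non-root flag
-- has a parent dart (colour `up`), with a depth function strictly
-- decreasing along parent darts; the tree edges are the darts
-- (y , up y) and their reverses.
record TrivialSpanningTree {n m : ℕ} (O : VoltageOperator n m) : Set where
  private G = graph (Y O)
  field
    root       : Flag G
    depth      : Flag G → ℕ
    root-depth : depth root ≡ 0
    root-uniq  : ∀ y → depth y ≡ 0 → y ≡ root
    up         : ∀ y → 0 < depth y →
                 Σ (Fin m) λ i → (depth (adj G i y) < depth y)
                                 × (η O y (i ∷ []) ≈ [])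

_⋊_ : {n m : ℕ} → Premaniplex n → VoltageOperator n m → Coloured m
Flag (X ⋊ O) = Flag (graph X) × Flag (graph (Y O))
adj  (X ⋊ O) i (x , y) = act (graph X) (η O y (i ∷ [])) x , adj (graph (Y O)) i y

PreservesConnectivity : {n m : ℕ} → VoltageOperator n m → Set₁
PreservesConnectivity {n} O = (X' : Premaniplex n) → Connected (graph X') → Connected (X' ⋊ O)

-- Coset premaniplexes C^n / K for K given by a membership predicate.
-- Flags are words, with ωK = ω'K iff ω⁻¹ω' ∈ K; i-adjacency ωK ↦ r_i ωK.

SameCoset : {n : ℕ} → (Word n → Set) → Word n → Word n → Set
SameCoset K ω ω' = K (inv ω ++ ω')

CoversCoset : {n : ℕ} → Premaniplex n → (Word n → Set) → Set
CoversCoset {n} X K =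
  Σ (Flag (graph X) → Word n) λ f →
      (∀ i x → SameCoset K (f (adj (graph X) i x)) (i ∷ f x))
    × (∀ ω → Σ (Flag (graph X)) λ x → SameCoset K (f x) ω)

-- L = Stab(y₀);  ζ(L ∩ L^υ) where L^υ = υ⁻¹Lυ, i.e. ω ∈ L^υ iff υωυ⁻¹ ∈ L
ζLL : {n m : ℕ} (O : VoltageOperator n m) → Flag (graph (Y O)) → Word m → Word n → Set
ζLL {n} {m} O y₀ υ k =
  Σ (Word m) λ ω → (act (graph (Y O)) ω y₀ ≡ y₀)
                 × (act (graph (Y O)) (υ ++ ω ++ inv υ) y₀ ≡ y₀)
                 × (k ≈ η O y₀ ω)

InducedBy : {n m : ℕ} (X : Premaniplex n) (O : VoltageOperator n m) →
            Automorphism (X ⋊ O) → Automorphism (graph X) → Set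
InducedBy X O φ σ = ∀ x y → Inverse.to (Automorphism.bij φ) (x , y)
                              ≡ (Inverse.to (Automorphism.bij σ) x , y)

{-# OPTIONS --safe #-}

-- An automorphism φ of X ⋊ Y commutes with the action of C^m.  Suppose it
-- sent (x, y₀) over υ⁻¹y₀ with υ ∉ L.  Since Y preserves connectivity, ζ is
-- onto C^n (look at the universal premaniplex), so every g ∈ Stab(x) is ζ(ω)
-- for some ω ∈ L; that ω fixes (x, y₀), hence φ(x, y₀), hence lies in
-- L ∩ L^υ.  Thus Stab(x) ⊆ ζ(L ∩ L^υ) and X would cover Z_υ.  So φ preserves
-- the base fibre, and transporting along the spanning tree (trivial voltages)
-- shows φ(x, y) = (σx, y); σ commutes with C^n, again because ζ is onto.

module Submission where

open import Defs
open import Data.Nat using (ℕ; zero; suc; _≤_; _<_; s≤s; _≤?_; ∣_-_∣)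
open import Data.Nat.Properties using (≤-trans; ≤-refl; <⇒≤; ≤-pred; ≰⇒>; n≤1+n; <⇒≢; <-asym; n≢0⇒n>0)
  renaming (_≟_ to _≟ℕ_)
open import Data.Fin using (Fin; toℕ)
open import Data.Fin.Properties using () renaming (_≟_ to _≟ᶠ_)
open import Data.List using ([]; _∷_; _++_)
open import Data.List.Properties using (++-assoc; ++-identityʳ; unfold-reverse; ≡-dec; reverse-involutive)
open import Data.Product using (Σ; _×_; _,_; proj₁; proj₂)
open import Data.Sum using (_⊎_; inj₁; inj₂)
open import Data.Unit using (⊤; tt)
open import Data.Empty using (⊥-elim)
open import Data.Irrelevant using ([_])
open import Data.Refinement using (Refinement-syntax; value; _,_)
open import Data.Refinement.Properties using (value-injective)
open import Function.Bundles using (Inverse; mk↔ₛ′)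
open import Function.Properties.Inverse using (↔-sym)
open import Relation.Binary.Bundles using (Setoid)
open import Relation.Binary.Definitions using (DecidableEquality)
open import Relation.Binary.PropositionalEquality
  using (_≡_; _≢_; refl; sym; trans; cong; cong₂; subst; module ≡-Reasoning)
open import Relation.Nullary using (¬_; Dec; yes; no)
open import Relation.Nullary.Decidable using (recompute; ¬?; _×-dec_)
import Relation.Binary.Reasoning.Setoid as SetoidReasoning

≈-setoid : ℕ → Setoid _ _
≈-setoid n = record
  { Carrier       = Word n
  ; _≈_           = _≈_
  ; isEquivalence = record { refl = ≈-refl ; sym = ≈-sym ; trans = ≈-trans }
  }

module ≈-Reasoning {n : ℕ} = SetoidReasoning (≈-setoid n)

module _ {n : ℕ} where

  ≈-congˡ : (w : Word n) {u v : Word n} → u ≈ v → w ++ u ≈ w ++ v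
  ≈-congˡ w u≈v = ≈-cong ≈-refl u≈v

  ≈-congʳ : (w : Word n) {u v : Word n} → u ≈ v → u ++ w ≈ v ++ w
  ≈-congʳ w u≈v = ≈-cong u≈v ≈-refl

  ≡⇒≈ : {u v : Word n} → u ≡ v → u ≈ v
  ≡⇒≈ refl = ≈-refl

  inv-cancelˡ : (u : Word n) → inv u ++ u ≈ []
  inv-cancelˡ []      = ≈-refl
  inv-cancelˡ (i ∷ u) = begin
    inv (i ∷ u) ++ i ∷ u         ≡⟨ cong (_++ i ∷ u) (unfold-reverse i u) ⟩
    (inv u ++ i ∷ []) ++ i ∷ u   ≡⟨ ++-assoc (inv u) (i ∷ []) (i ∷ u) ⟩
    inv u ++ (i ∷ i ∷ []) ++ u   ≈⟨ ≈-congˡ (inv u) (≈-congʳ u (≈-inv i)) ⟩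
    inv u ++ u                   ≈⟨ inv-cancelˡ u ⟩
    []                           ∎
    where open ≈-Reasoning {n}

  ≈[]-cancelʳ : {u v : Word n} → u ++ v ≈ [] → v ≈ [] → u ≈ []
  ≈[]-cancelʳ {u} uv≈[] v≈[] =
    ≈-trans (≡⇒≈ (sym (++-identityʳ u))) (≈-trans (≈-congˡ u (≈-sym v≈[])) uv≈[])

  idempotent⇒≈[] : {u : Word n} → u ≈ u ++ u → u ≈ []
  idempotent⇒≈[] {u} u≈uu = ≈-sym (begin
    []                 ≈⟨ inv-cancelˡ u ⟨
    inv u ++ u         ≈⟨ ≈-congˡ (inv u) u≈uu ⟩
    inv u ++ u ++ u    ≡⟨ ++-assoc (inv u) u u ⟨
    (inv u ++ u) ++ u  ≈⟨ ≈-congʳ u (inv-cancelˡ u) ⟩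
    u                  ∎)
    where open ≈-Reasoning {n}

act-++ : {n : ℕ} (G : Coloured n) (u v : Word n) (x : Flag G) →
         act G (u ++ v) x ≡ act G u (act G v x)
act-++ G []      v x = refl
act-++ G (i ∷ u) v x = cong (adj G i) (act-++ G u v x)

module _ {n : ℕ} (X : Premaniplex n) where
  private G = graph X

  act-resp-≈ : {u v : Word n} → u ≈ v → ∀ x → act G u x ≡ act G v x
  act-resp-≈ ≈-refl          x = refl
  act-resp-≈ (≈-sym p)       x = sym (act-resp-≈ p x)
  act-resp-≈ (≈-trans p q)   x = trans (act-resp-≈ p x) (act-resp-≈ q x)
  act-resp-≈ (≈-inv i)       x = Premaniplex.involution X i x
  act-resp-≈ (≈-comm i j f)  x = Premaniplex.alternating X i j f x
  act-resp-≈ (≈-cong {u} {u'} {v} {v'} p q) x = begin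
    act G (u ++ v) x      ≡⟨ act-++ G u v x ⟩
    act G u (act G v x)   ≡⟨ act-resp-≈ p (act G v x) ⟩
    act G u' (act G v x)  ≡⟨ cong (act G u') (act-resp-≈ q x) ⟩
    act G u' (act G v' x) ≡⟨ act-++ G u' v' x ⟨
    act G (u' ++ v') x    ∎
    where open ≡-Reasoning

  act-inv-act : ∀ u x → act G (inv u) (act G u x) ≡ x
  act-inv-act u x = trans (sym (act-++ G (inv u) u x)) (act-resp-≈ (inv-cancelˡ u) x)

  act-act-inv : ∀ u x → act G u (act G (inv u) x) ≡ x
  act-act-inv u x =
    subst (λ v → act G v (act G (inv u) x) ≡ x) (reverse-involutive u) (act-inv-act (inv u) x)

  inv-fixes⇒fixes : ∀ u x → act G (inv u) x ≡ x → act G u x ≡ x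
  inv-fixes⇒fixes u x fixed = trans (cong (act G u) (sym fixed)) (act-act-inv u x)

  fixes-act⇒conjugate-fixes : ∀ u ω x → act G ω (act G u x) ≡ act G u x →
                                    act G (inv u ++ ω ++ inv (inv u)) x ≡ x
  fixes-act⇒conjugate-fixes u ω x fixed = begin
    act G (inv u ++ ω ++ inv (inv u)) x          ≡⟨ cong (λ v → act G (inv u ++ ω ++ v) x) (reverse-involutive u) ⟩
    act G (inv u ++ ω ++ u) x                    ≡⟨ act-++ G (inv u) (ω ++ u) x ⟩
    act G (inv u) (act G (ω ++ u) x)             ≡⟨ cong (act G (inv u)) (act-++ G ω u x) ⟩
    act G (inv u) (act G ω (act G u x))          ≡⟨ cong (act G (inv u)) fixed ⟩
    act G (inv u) (act G u x)                    ≡⟨ act-inv-act u x ⟩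
    x                                            ∎
    where open ≡-Reasoning

-- The universal n-premaniplex

-- Flags are words with no letter repeated at once and no r_c directly after
-- r_b when c + 2 ≤ b.
module Universal (n : ℕ) where

  _≪_ : Fin n → Fin n → Set
  c ≪ b = suc (suc (toℕ c)) ≤ toℕ b

  ≪⇒< : ∀ {c b} → c ≪ b → toℕ c < toℕ b
  ≪⇒< c≪b = ≤-trans (n≤1+n _) c≪b

  ≪-irrefl : ∀ {a} → ¬ a ≪ a
  ≪-irrefl a≪a = <⇒≢ (≪⇒< a≪a) refl

  ≪⇒Far : ∀ {c b} → c ≪ b → Far b c
  ≪⇒Far = go _ _
    where
    go : ∀ b c → suc (suc c) ≤ b → 2 ≤ ∣ b - c ∣
    go (suc b) zero    c≪b = c≪b
    go (suc b) (suc c) c≪b = go b c (≤-pred c≪b)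

  Far⇒≪⊎≫ : ∀ {a c} → Far a c → c ≪ a ⊎ a ≪ c
  Far⇒≪⊎≫ = go _ _
    where
    go : ∀ a c → 2 ≤ ∣ a - c ∣ → suc (suc c) ≤ a ⊎ suc (suc a) ≤ c
    go zero    c       far = inj₂ far
    go (suc a) zero    far = inj₁ far
    go (suc a) (suc c) far with go a c far
    ... | inj₁ c≪a = inj₁ (s≤s c≪a)
    ... | inj₂ a≪c = inj₂ (s≤s a≪c)

  Precedes : Fin n → Word n → Set
  Precedes b []      = ⊤
  Precedes b (c ∷ _) = b ≢ c × ¬ (c ≪ b)

  Normal : Word n → Set
  Normal []      = ⊤
  Normal (b ∷ w) = Precedes b w × Normal w

  precedes? : ∀ b w → Dec (Precedes b w)
  precedes? b []      = yes tt
  precedes? b (c ∷ _) = ¬? (b ≟ᶠ c) ×-dec ¬? (suc (suc (toℕ c)) ≤? toℕ b)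

  normal? : ∀ w → Dec (Normal w)
  normal? []      = yes tt
  normal? (b ∷ w) = precedes? b w ×-dec normal? w

  <⇒precedes : ∀ {b c} (w : Word n) → toℕ b < toℕ c → Precedes b (c ∷ w)
  <⇒precedes w b<c = (λ b≡c → <⇒≢ b<c (cong toℕ b≡c)) , (λ c≪b → <-asym b<c (≪⇒< c≪b))

  precedes-≪ : ∀ {b a} w → b ≪ a → Precedes a w → Precedes b w
  precedes-≪ []      b≪a _            = tt
  precedes-≪ (e ∷ w) b≪a (_ , e≪̸a) = <⇒precedes w (≤-pred (≤-trans b≪a (≤-pred (≰⇒> e≪̸a))))

  data Placement (a b : Fin n) : Set where
    same     : a ≡ b → Placement a b
    passes   : b ≪ a → Placement a b
    precedes : Precedes a (b ∷ []) → Placement a b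

  placement : ∀ a b → Placement a b
  placement a b with a ≟ᶠ b
  ... | yes a≡b = same a≡b
  ... | no a≢b with suc (suc (toℕ b)) ≤? toℕ a
  ...   | yes b≪a = passes b≪a
  ...   | no b≪̸a = precedes (a≢b , b≪̸a)

  mul : Fin n → Word n → Word n
  mul a []      = a ∷ []
  mul a (b ∷ w) with placement a b
  ... | same _     = w
  ... | passes _   = b ∷ mul a w
  ... | precedes _ = a ∷ b ∷ w

  mul-same : ∀ a w → mul a (a ∷ w) ≡ w
  mul-same a w with placement a a
  ... | same _              = refl
  ... | passes a≪a          = ⊥-elim (≪-irrefl a≪a)
  ... | precedes (a≢a , _)  = ⊥-elim (a≢a refl)

  mul-passes : ∀ {a b} w → b ≪ a → mul a (b ∷ w) ≡ b ∷ mul a w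
  mul-passes {a} {b} w b≪a with placement a b
  ... | same refl            = ⊥-elim (≪-irrefl b≪a)
  ... | passes _             = refl
  ... | precedes (_ , b≪̸a)  = ⊥-elim (b≪̸a b≪a)

  mul-precedes : ∀ a w → Precedes a w → mul a w ≡ a ∷ w
  mul-precedes a []      _             = refl
  mul-precedes a (b ∷ w) (a≢b , b≪̸a) with placement a b
  ... | same a≡b   = ⊥-elim (a≢b a≡b)
  ... | passes b≪a = ⊥-elim (b≪̸a b≪a)
  ... | precedes _ = refl

  precedes-mul : ∀ {b a} w → b ≪ a → Precedes b w → Normal w → Precedes b (mul a w)
  precedes-mul         []      b≪a _   _             = <⇒precedes [] (≪⇒< b≪a)
  precedes-mul {a = a} (d ∷ w) b≪a b◁d (d◁w , _) with placement a d
  ... | same refl  = precedes-≪ w b≪a d◁w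
  ... | passes _   = b◁d
  ... | precedes _ = <⇒precedes (d ∷ w) (≪⇒< b≪a)

  mul-normal : ∀ a w → Normal w → Normal (mul a w)
  mul-normal a []      _              = tt , tt
  mul-normal a (b ∷ w) (b◁w , w-nf) with placement a b
  ... | same refl    = w-nf
  ... | passes b≪a   = precedes-mul w b≪a b◁w w-nf , mul-normal a w w-nf
  ... | precedes a◁b = a◁b , b◁w , w-nf

  mul-involutive : ∀ a w → Normal w → mul a (mul a w) ≡ w
  mul-involutive a []      _              = mul-same a []
  mul-involutive a (b ∷ w) (b◁w , w-nf) with placement a b
  ... | same refl  = mul-precedes a w b◁w
  ... | passes b≪a = trans (mul-passes (mul a w) b≪a) (cong (b ∷_) (mul-involutive a w w-nf))
  ... | precedes _ = mul-same a (b ∷ w)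

  mul-comm-precedes : ∀ {a c} w → c ≪ a → Precedes c w → Normal w →
                      mul a (c ∷ w) ≡ mul c (mul a w)
  mul-comm-precedes {a} {c} w c≪a c◁w w-nf =
    trans (mul-passes w c≪a) (sym (mul-precedes c (mul a w) (precedes-mul w c≪a c◁w w-nf)))

  mul-comm-≪ : ∀ {a c} w → c ≪ a → Normal w → mul a (mul c w) ≡ mul c (mul a w)
  mul-comm-≪ []      c≪a _ = mul-comm-precedes [] c≪a tt tt
  mul-comm-≪ {a} {c} (b ∷ w) c≪a (b◁w , w-nf) with placement c b
  ... | same refl =
    sym (trans (cong (mul c) (mul-passes w c≪a)) (mul-same c (mul a w)))
  ... | passes b≪c =
    trans (mul-passes (mul c w) b≪a)
      (trans (cong (b ∷_) (mul-comm-≪ w c≪a w-nf))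
        (sym (trans (cong (mul c) (mul-passes w b≪a)) (mul-passes (mul a w) b≪c))))
    where b≪a = ≤-trans b≪c (<⇒≤ (≪⇒< c≪a))
  ... | precedes c◁b = mul-comm-precedes (b ∷ w) c≪a c◁b (b◁w , w-nf)

  mul-comm : ∀ {a c} w → Far a c → Normal w → mul a (mul c w) ≡ mul c (mul a w)
  mul-comm w far w-nf with Far⇒≪⊎≫ far
  ... | inj₁ c≪a = mul-comm-≪ w c≪a w-nf
  ... | inj₂ a≪c = sym (mul-comm-≪ w a≪c w-nf)

  swap : ∀ {a b} → Far a b → (b ∷ a ∷ []) ≈ (a ∷ b ∷ [])
  swap {a} {b} far = begin
    b ∷ a ∷ []                  ≈⟨ ≈-congˡ (b ∷ a ∷ []) (≈-comm a b far) ⟨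
    b ∷ a ∷ a ∷ b ∷ a ∷ b ∷ []  ≈⟨ ≈-congˡ (b ∷ []) (≈-congʳ (b ∷ a ∷ b ∷ []) (≈-inv a)) ⟩
    b ∷ b ∷ a ∷ b ∷ []          ≈⟨ ≈-congʳ (a ∷ b ∷ []) (≈-inv b) ⟩
    a ∷ b ∷ []                  ∎
    where open ≈-Reasoning {n}

  mul-sound : ∀ a w → mul a w ≈ a ∷ w
  mul-sound a []      = ≈-refl
  mul-sound a (b ∷ w) with placement a b
  ... | same refl  = ≈-sym (≈-congʳ w (≈-inv a))
  ... | passes b≪a = ≈-trans (≈-congˡ (b ∷ []) (mul-sound a w)) (≈-congʳ w (swap (≪⇒Far b≪a)))
  ... | precedes _ = ≈-refl

  NormalWord : Set
  NormalWord = [ w ∈ Word n ∣ Normal w ]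

  normal : ∀ {w} → .(Normal w) → Normal w
  normal {w} = recompute (normal? w)

  push : Fin n → NormalWord → NormalWord
  push i (w , [ w-nf ]) = mul i w , [ mul-normal i w w-nf ]

  𝒰 : Premaniplex n
  𝒰 = record
    { graph       = record { Flag = NormalWord ; adj = push }
    ; involution  = λ { i (w , [ w-nf ]) → value-injective (mul-involutive i w (normal w-nf)) }
    ; alternating = λ { i j far (w , [ w-nf ]) → value-injective (alternating i j far w (normal w-nf)) }
    }
    where
    alternating : ∀ i j → Far i j → ∀ w → Normal w → mul i (mul j (mul i (mul j w))) ≡ w
    alternating i j far w w-nf =
      trans (cong (λ v → mul i (mul j v)) (mul-comm w far w-nf))
        (trans (cong (mul i) (mul-involutive j (mul i w) (mul-normal i w w-nf)))
          (mul-involutive i w w-nf))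

  base : NormalWord
  base = [] , [ tt ]

  value-act-base : ∀ u → value (act (graph 𝒰) u base) ≈ u
  value-act-base []      = ≈-refl
  value-act-base (i ∷ u) = ≈-trans (mul-sound i _) (≈-congˡ (i ∷ []) (value-act-base u))

  act-base-faithful : ∀ u v → act (graph 𝒰) u base ≡ act (graph 𝒰) v base → u ≈ v
  act-base-faithful u v eq =
    ≈-trans (≈-sym (value-act-base u)) (≈-trans (≡⇒≈ (cong value eq)) (value-act-base v))

  act-value-base : ∀ t → act (graph 𝒰) (value t) base ≡ t
  act-value-base (w , [ w-nf ]) = value-injective (go w (normal w-nf))
    where
    go : ∀ w → Normal w → value (act (graph 𝒰) w base) ≡ w
    go []      _            = refl
    go (b ∷ w) (b◁w , w-nf) = trans (cong (mul b) (go w w-nf)) (mul-precedes b w b◁w)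

  𝒰-connected : Connected (graph 𝒰)
  𝒰-connected t t' = value t' ++ inv (value t) , (begin
    act G (value t' ++ inv (value t)) t         ≡⟨ act-++ G (value t') (inv (value t)) t ⟩
    act G (value t') (act G (inv (value t)) t)  ≡⟨ cong (act G (value t')) back-to-base ⟩
    act G (value t') base                       ≡⟨ act-value-base t' ⟩
    t'                                          ∎)
    where
    open ≡-Reasoning
    G = graph 𝒰
    back-to-base : act G (inv (value t)) t ≡ base
    back-to-base = trans (cong (act G (inv (value t))) (sym (act-value-base t)))
                         (act-inv-act 𝒰 (value t) base)

module _ {n m : ℕ} (O : VoltageOperator n m) where
  private YG = graph (Y O)

  η-[] : ∀ y → η O y [] ≈ []
  η-[] y = idempotent⇒≈[] (η-comp O y [] [])

  act-⋊ : (X : Premaniplex n) → ∀ w x y →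
          act (X ⋊ O) w (x , y) ≡ (act (graph X) (η O y w) x , act YG w y)
  act-⋊ X []      x y = cong (_, y) (sym (act-resp-≈ X (η-[] y) x))
  act-⋊ X (i ∷ w) x y =
    trans (cong (adj (X ⋊ O) i) (act-⋊ X w x y)) (cong (_, act YG (i ∷ w) y) (begin
      act G ηᵢ (act G (η O y w) x)  ≡⟨ act-++ G ηᵢ (η O y w) x ⟨
      act G (ηᵢ ++ η O y w) x       ≡⟨ act-resp-≈ X (η-comp O y w (i ∷ [])) x ⟨
      act G (η O y (i ∷ w)) x       ∎))
    where
    open ≡-Reasoning
    G = graph X
    ηᵢ = η O (act YG w y) (i ∷ [])

  proj₂-act-⋊ : (X : Premaniplex n) → ∀ w p → proj₂ (act (X ⋊ O) w p) ≡ act YG w (proj₂ p)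
  proj₂-act-⋊ X w (x , y) = cong proj₂ (act-⋊ X w x y)

  act-⋊-≈ : (X : Premaniplex n) → ∀ {ω g y y'} → η O y ω ≈ g → act YG ω y ≡ y' →
            ∀ x → act (X ⋊ O) ω (x , y) ≡ (act (graph X) g x , y')
  act-⋊-≈ X {ω} {y = y} η≈g ω-y x =
    trans (act-⋊ X ω x y) (cong₂ _,_ (act-resp-≈ X η≈g x) ω-y)

  -- A path in 𝒰 ⋊ Y from (1, y) to (g, y) is an ω ∈ Stab(y) with ζ(ω) = g.
  ζ-surjective : PreservesConnectivity O → ∀ y g →
                 Σ (Word m) λ ω → act YG ω y ≡ y × η O y ω ≈ g
  ζ-surjective preserves y g = ω , cong proj₂ ends , act-base-faithful _ _ (cong proj₁ ends)
    where
    open Universal n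
    path = preserves 𝒰 𝒰-connected (base , y) (act (graph 𝒰) g base , y)
    ω = proj₁ path
    ends : (act (graph 𝒰) (η O y ω) base , act YG ω y) ≡ (act (graph 𝒰) g base , y)
    ends = trans (sym (act-⋊ 𝒰 ω base y)) (proj₂ path)

  TrivialPath : Flag YG → Flag YG → Set
  TrivialPath y y' = Σ (Word m) λ s → act YG s y ≡ y' × η O y s ≈ []

  trivialPath-sym : ∀ {y y'} → TrivialPath y y' → TrivialPath y' y
  trivialPath-sym {y} (s , refl , s-trivial) =
    inv s , act-inv-act (Y O) s y ,
    ≈[]-cancelʳ (≈-trans (≈-sym (η-comp O y s (inv s)))
                         (≈-trans (η-resp O y (inv-cancelˡ s)) (η-[] y)))
                s-trivial

  trivialPath-trans : ∀ {y y' y''} → TrivialPath y y' → TrivialPath y' y'' → TrivialPath y y''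
  trivialPath-trans {y} (s , refl , s-trivial) (t , refl , t-trivial) =
    t ++ s , act-++ YG t s y , ≈-trans (η-comp O y s t) (≈-cong t-trivial s-trivial)

module _ {n m : ℕ} {O : VoltageOperator n m} (T : TrivialSpanningTree O) where
  open TrivialSpanningTree T
  private YG = graph (Y O)

  trivialPath-from-root : ∀ y → TrivialPath O root y
  trivialPath-from-root y = go (suc (depth y)) y ≤-refl
    where
    go : ∀ k y → depth y < k → TrivialPath O root y
    go (suc k) y depth<k with depth y ≟ℕ 0
    ... | yes depth≡0 = [] , sym (root-uniq y depth≡0) , η-[] O root
    ... | no depth≢0 with up y (n≢0⇒n>0 depth≢0)
    ...   | i , depth-decreases , i-trivial =
      trivialPath-trans O (go k (adj YG i y) (≤-trans depth-decreases (≤-pred depth<k)))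
                          (trivialPath-sym O ((i ∷ []) , refl , i-trivial))

  trivialPath : ∀ y y' → TrivialPath O y y'
  trivialPath y y' =
    trivialPath-trans O (trivialPath-sym O (trivialPath-from-root y)) (trivialPath-from-root y')

  private
    treeWord : Flag YG → Word m
    treeWord y = proj₁ (trivialPath-from-root y)

    treeWord-reaches : ∀ y → act YG (treeWord y) root ≡ y
    treeWord-reaches y = proj₁ (proj₂ (trivialPath-from-root y))

  -- Flags are told apart by the words of their tree paths from the root.
  _≟Y_ : DecidableEquality (Flag YG)
  y ≟Y y' with ≡-dec _≟ᶠ_ (treeWord y) (treeWord y')
  ... | yes same = yes (begin
    y                            ≡⟨ treeWord-reaches y ⟨
    act YG (treeWord y) root     ≡⟨ cong (λ s → act YG s root) same ⟩
    act YG (treeWord y') root    ≡⟨ treeWord-reaches y' ⟩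
    y'                           ∎)
    where open ≡-Reasoning
  ... | no different = no (λ y≡y' → different (cong treeWord y≡y'))

module _ {n : ℕ} {G : Coloured n} where

  apply : Automorphism G → Flag G → Flag G
  apply φ = Inverse.to (Automorphism.bij φ)

  apply-act : (φ : Automorphism G) → ∀ w p → apply φ (act G w p) ≡ act G w (apply φ p)
  apply-act φ []      p = refl
  apply-act φ (i ∷ w) p =
    trans (Automorphism.preserve φ i (act G w p)) (cong (adj G i) (apply-act φ w p))

  apply-fixes : (φ : Automorphism G) → ∀ {w p} → act G w p ≡ p → act G w (apply φ p) ≡ apply φ p
  apply-fixes φ {w} {p} w-fixes = trans (sym (apply-act φ w p)) (cong (apply φ) w-fixes)

  _⁻¹ : Automorphism G → Automorphism G
  φ ⁻¹ = record { bij = ↔-sym (Automorphism.bij φ) ; preserve = preserve⁻¹ }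
    where
    open Inverse (Automorphism.bij φ)
    preserve⁻¹ : ∀ i p → from (adj G i p) ≡ adj G i (from p)
    preserve⁻¹ i p = begin
      from (adj G i p)              ≡⟨ cong (λ q → from (adj G i q)) (strictlyInverseˡ p) ⟨
      from (adj G i (to (from p)))  ≡⟨ cong from (Automorphism.preserve φ i (from p)) ⟨
      from (to (adj G i (from p)))  ≡⟨ strictlyInverseʳ (adj G i (from p)) ⟩
      adj G i (from p)              ∎
      where open ≡-Reasoning

stabiliser⊆⇒coversCoset : {n : ℕ} (X : Premaniplex n) → Connected (graph X) →
  (K : Word n → Set) (x : Flag (graph X)) → (∀ g → act (graph X) g x ≡ x → K g) →
  CoversCoset X K
stabiliser⊆⇒coversCoset X connected K x stabiliser⊆K =
  coset , (λ i z → returns (adj G i z) (i ∷ coset z) (cong (adj G i) (reaches z))) ,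
          (λ ω → act G ω x , returns (act G ω x) ω refl)
  where
  G = graph X
  coset : Flag G → Word _
  coset z = proj₁ (connected x z)
  reaches : ∀ z → act G (coset z) x ≡ z
  reaches z = proj₂ (connected x z)
  returns : ∀ z u → act G u x ≡ z → K (inv (coset z) ++ u)
  returns z u u-reaches = stabiliser⊆K _ (begin
    act G (inv (coset z) ++ u) x               ≡⟨ act-++ G (inv (coset z)) u x ⟩
    act G (inv (coset z)) (act G u x)          ≡⟨ cong (act G (inv (coset z))) (trans u-reaches (sym (reaches z))) ⟩
    act G (inv (coset z)) (act G (coset z) x)  ≡⟨ act-inv-act X (coset z) x ⟩
    x                                          ∎)
    where open ≡-Reasoning

module _ {n m : ℕ} (X : Premaniplex n) (O : VoltageOperator n m) (y₀ : Flag (graph (Y O))) where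
  private
    XG = graph X
    YG = graph (Y O)
    P  = X ⋊ O

  baseMap : Automorphism P → Flag XG → Flag XG
  baseMap φ x = proj₁ (apply φ (x , y₀))

  PreservesBaseFibre : Automorphism P → Set
  PreservesBaseFibre φ = ∀ x → proj₂ (apply φ (x , y₀)) ≡ y₀

  apply-base : (φ : Automorphism P) → PreservesBaseFibre φ → ∀ x → apply φ (x , y₀) ≡ (baseMap φ x , y₀)
  apply-base φ fixed x = cong (baseMap φ x ,_) (fixed x)

  -- A lift ω ∈ L of g ∈ Stab(x) fixes (x, y₀), hence φ(x, y₀), hence wy₀.
  stabiliser⊆ζLL : PreservesConnectivity O → (φ : Automorphism P) → ∀ x w →
    proj₂ (apply φ (x , y₀)) ≡ act YG w y₀ → ∀ g → act XG g x ≡ x → ζLL O y₀ (inv w) g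
  stabiliser⊆ζLL preserves φ x w over-w g g-fixes with ζ-surjective O preserves y₀ g
  ... | ω , ω-fixes , ηω≈g =
    ω , ω-fixes , fixes-act⇒conjugate-fixes (Y O) w ω y₀ ω-fixes-image , ≈-sym ηω≈g
    where
    ω-fixes-flag : act P ω (x , y₀) ≡ (x , y₀)
    ω-fixes-flag = trans (act-⋊-≈ O X ηω≈g ω-fixes x) (cong (_, y₀) g-fixes)
    ω-fixes-image : act YG ω (act YG w y₀) ≡ act YG w y₀
    ω-fixes-image = subst (λ y → act YG ω y ≡ y) over-w
      (trans (sym (proj₂-act-⋊ O X ω (apply φ (x , y₀)))) (cong proj₂ (apply-fixes φ {ω} ω-fixes-flag)))

  preservesBaseFibre : TrivialSpanningTree O → Connected XG → PreservesConnectivity O →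
    (∀ υ → act YG υ y₀ ≢ y₀ → ¬ CoversCoset X (ζLL O y₀ υ)) →
    (φ : Automorphism P) → PreservesBaseFibre φ
  preservesBaseFibre T connected preserves no-cover φ x with _≟Y_ T (proj₂ (apply φ (x , y₀))) y₀
  ... | yes fixed = fixed
  ... | no moved  = ⊥-elim (no-cover (inv w) inv-w-moves
                      (stabiliser⊆⇒coversCoset X connected _ x (stabiliser⊆ζLL preserves φ x w over-w)))
    where
    path = preserves X connected (x , y₀) (apply φ (x , y₀))
    w = proj₁ path
    over-w : proj₂ (apply φ (x , y₀)) ≡ act YG w y₀
    over-w = trans (cong proj₂ (sym (proj₂ path))) (proj₂-act-⋊ O X w (x , y₀))
    inv-w-moves : act YG (inv w) y₀ ≢ y₀
    inv-w-moves fixed = moved (trans over-w (inv-fixes⇒fixes (Y O) w y₀ fixed))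

  apply-lift : (φ : Automorphism P) → PreservesBaseFibre φ →
    ∀ ω (f : Flag XG → Flag XG) y → (∀ z → act P ω (z , y₀) ≡ (f z , y)) →
    ∀ x → apply φ (f x , y) ≡ (f (baseMap φ x) , y)
  apply-lift φ fixed ω f y lift x = begin
    apply φ (f x , y)              ≡⟨ cong (apply φ) (lift x) ⟨
    apply φ (act P ω (x , y₀))     ≡⟨ apply-act φ ω (x , y₀) ⟩
    act P ω (apply φ (x , y₀))     ≡⟨ cong (act P ω) (apply-base φ fixed x) ⟩
    act P ω (baseMap φ x , y₀)     ≡⟨ lift (baseMap φ x) ⟩
    (f (baseMap φ x) , y)          ∎
    where open ≡-Reasoning

  fibrewise : TrivialSpanningTree O → (φ : Automorphism P) → PreservesBaseFibre φ →
    ∀ x y → apply φ (x , y) ≡ (baseMap φ x , y)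
  fibrewise T φ fixed x y = apply-lift φ fixed s (λ z → z) y (act-⋊-≈ O X s-trivial s-ends) x
    where
    path = trivialPath T y₀ y
    s = proj₁ path
    s-ends = proj₁ (proj₂ path)
    s-trivial = proj₂ (proj₂ path)

  baseMap-commutes : PreservesConnectivity O → (φ : Automorphism P) → PreservesBaseFibre φ →
    ∀ g x → baseMap φ (act XG g x) ≡ act XG g (baseMap φ x)
  baseMap-commutes preserves φ fixed g x with ζ-surjective O preserves y₀ g
  ... | ω , ω-fixes , ηω≈g =
    cong proj₁ (apply-lift φ fixed ω (act XG g) y₀ (act-⋊-≈ O X ηω≈g ω-fixes) x)

  baseMap-inverse : (φ ψ : Automorphism P) → PreservesBaseFibre ψ →
    (∀ p → apply φ (apply ψ p) ≡ p) → ∀ x → baseMap φ (baseMap ψ x) ≡ x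
  baseMap-inverse φ ψ fixed φψ≡id x =
    cong proj₁ (trans (cong (apply φ) (sym (apply-base ψ fixed x))) (φψ≡id (x , y₀)))

  inducedAutomorphism : PreservesConnectivity O → (φ : Automorphism P) →
    PreservesBaseFibre φ → PreservesBaseFibre (φ ⁻¹) → Automorphism XG
  inducedAutomorphism preserves φ fixed fixed⁻¹ = record
    { bij      = mk↔ₛ′ (baseMap φ) (baseMap (φ ⁻¹))
                   (baseMap-inverse φ (φ ⁻¹) fixed⁻¹ (Inverse.strictlyInverseˡ (Automorphism.bij φ)))
                   (baseMap-inverse (φ ⁻¹) φ fixed (Inverse.strictlyInverseʳ (Automorphism.bij φ)))
    ; preserve = λ i → baseMap-commutes preserves φ fixed (i ∷ [])
    }

theorem5p7 : (n m : ℕ) (X : Premaniplex n) (O : VoltageOperator n m) →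
    TrivialSpanningTree O →
    Connected (graph X) →
    PreservesConnectivity O →
    (y₀ : Flag (graph (Y O))) →
    (∀ υ → act (graph (Y O)) υ y₀ ≢ y₀ → ¬ CoversCoset X (ζLL O y₀ υ)) →
    (φ : Automorphism (X ⋊ O)) → Σ (Automorphism (graph X)) (InducedBy X O φ)
theorem5p7 n m X O T connected preserves y₀ no-cover φ =
  inducedAutomorphism X O y₀ preserves φ (fixed φ) (fixed (φ ⁻¹)) ,
  fibrewise X O y₀ T φ (fixed φ)
  where
  fixed : (ψ : Automorphism (X ⋊ O)) → PreservesBaseFibre X O y₀ ψ
  fixed = preservesBaseFibre X O y₀ T connected preserves no-cover
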